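{- For each integer $r\ge 1$ there exists an integer $N_r$ such that the following holds. Let $\mathcal{F}\subseteq \binom{[n]}{r}$ satisfy \[ \bigcap_{A\in \mathcal{F}}A=\varnothing,\qquad \mathcal{G}_1\neq\varnothing,\qquad n-r\ge N_r, \] where $\mathcal{G}_1:=\{A\in\mathcal{F}: i_{\mathcal{F}}(A)\ge 1\}$. Then $\Phi_{n,r}(\mathcal{F})<1$.
   Context: $\binom{[n]}{r}$ denotes the family of all $r$-element subsets of $[n]$. For $A\in\mathcal{F}$, $i_{\mathcal{F}}(A):=\min_{B\in\mathcal{F}}|A\cap B|$, and $\Phi_{n,r}(\mathcal{F}):=\sum_{A\in \mathcal{F}}\binom{n-i_{\mathcal{F}}(A)}{r-i_{\mathcal{F}}(A)}^{ -1}$. -}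

module Defs where

open import Data.Nat using (ℕ; zero; suc; _⊓_; _∸_)
open import Data.Nat.Combinatorics using (_C_)
open import Data.Integer using (+_)
open import Data.List using (List; []; _∷_; foldr; map; sum)
open import Data.Fin.Subset using (Subset; _∩_; ∣_∣)
open import Data.Rational using (ℚ; _/_; 0ℚ; _+_)

-- i_F(A) = min_{B ∈ F} |A ∩ B|.  The fold starts at n, which is an upper
-- bound for every |A ∩ B|, so for nonempty F this is exactly the minimum.
iF : ∀ {n} → List (Subset n) → Subset n → ℕ
iF {n} F A = foldr (λ B m → ∣ A ∩ B ∣ ⊓ m) n F

-- reciprocal of a natural number as a rational (only applied to
-- positive binomial coefficients; value at 0 is an irrelevant convention)
recipℕ : ℕ → ℚ
recipℕ zero = 0ℚ
recipℕ (suc k) = + 1 / suc k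

sumℚ : List ℚ → ℚ
sumℚ = foldr _+_ 0ℚ

Φ : (n r : ℕ) → List (Subset n) → ℚ
Φ n r F = sumℚ (map (λ A → recipℕ ((n ∸ iF F A) C (r ∸ iF F A))) F)

-- Some A₀ ∈ F meets every member of F, and since ⋂ F = ∅ each x ∈ A₀ is missed by
-- some B_x ∈ F.  The set U = A₀ ∪ ⋃_{x ∈ A₀} B_x has at most r + r² points, and every
-- A ∈ F meets A₀ in some x, with A ∩ B_x ⊊ A ∩ U; hence |A ∩ U| > i(A), and i(A) < r.
-- So the members with i(A) = i all have at least i + 1 points in U, and there are at
-- most 2^|U| C(n-i-1, r-i-1) = 2^|U| (r-i)/(n-i) C(n-i, r-i) ≤ C(n-i, r-i)/(r+1) of
-- them once n - r ≥ r (r+1) 2^(r+r²).  Each of the r levels i < r thus contributes at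
-- most 1/(r+1) to Φ, and Φ ≤ r/(r+1) < 1.

{-# OPTIONS --safe #-}
module Submission where

open import Data.Bool using (Bool; true; false; _≟_)
open import Data.Fin using (Fin; zero; suc)
open import Data.Fin.Subset using (Subset; ∣_∣; _∩_; _∪_; ⊥; _∈_; _∉_; _⊆_; _⊂_; Nonempty)
open import Data.Fin.Subset.Properties
  using (∣p∣≤n; ∣p∩q∣≤∣p∣; ∣⊥∣≡0; p⊆p∪q; q⊆p∪q; x∈p∩q⁺; x∈p∩q⁻; p⊂q⇒∣p∣<∣q∣)
open import Data.Integer as ℤ using (+≤+; +<+)
import Data.Integer.Properties as ℤ
open import Data.List using (List; []; _∷_; length; map; filter)
open import Data.List.Membership.Propositional using (find) renaming (_∈_ to _∈ₗ_)
open import Data.List.Relation.Unary.All as All using (All; []; _∷_)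
import Data.List.Relation.Unary.All.Properties as All
open import Data.List.Relation.Unary.AllPairs using ([]; _∷_)
open import Data.List.Relation.Unary.Any using (Any; here; there)
open import Data.List.Relation.Unary.Unique.Propositional using (Unique)
import Data.List.Relation.Unary.Unique.Propositional.Properties as Unique
open import Data.Nat as ℕ hiding (_≟_; _<_; _/_)
open import Data.Nat.Combinatorics using (_C_; nC1≡n; nCk+nC[k+1]≡[n+1]C[k+1])
open import Data.Nat.Properties hiding (_≟_)
open import Data.Product using (_×_; _,_; ∃; proj₁; proj₂)
open import Data.Rational as ℚ using (ℚ; _/_; 1ℚ; _<_; fromℚᵘ)
import Data.Rational.Properties as ℚ
open import Data.Rational.Unnormalised as ℚᵘ using (ℚᵘ; mkℚᵘ; *≤*; *<*; *≡*)
import Data.Rational.Unnormalised.Properties as ℚᵘ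
open import Algebra.Bundles using (CommutativeMonoid)
import Algebra.Properties.CommutativeSemigroup as CommSemigroup
open import Algebra.Definitions.RawMonoid ℚ.+-0-rawMonoid using () renaming (_×_ to _×ℚ_)
open import Data.Vec using (_∷_; []; here; there)
open import Function using (_∘_)
open import Relation.Nullary using (¬_; yes; no; contradiction)
open import Relation.Nullary.Decidable using (¬?)
import Relation.Unary as U
open import Relation.Binary.PropositionalEquality

open import Defs

private variable m n : ℕ

mCk≤[1+m]Ck : ∀ m k → m C k ≤ suc m C k
mCk≤[1+m]Ck m zero    = ≤-refl
mCk≤[1+m]Ck m (suc k) = ≤-trans (m≤n+m (m C suc k) (m C k)) (≤-reflexive (nCk+nC[k+1]≡[n+1]C[k+1] m k))

C-monoˡ-≤ : ∀ {m m′} k → m ≤ m′ → m C k ≤ m′ C k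
C-monoˡ-≤ k m≤m′ = stepwise (≤⇒≤′ m≤m′)
  where
  stepwise : ∀ {m m′} → m ≤′ m′ → m C k ≤ m′ C k
  stepwise ≤′-refl             = ≤-refl
  stepwise (≤′-step {n} m≤n) = ≤-trans (stepwise m≤n) (mCk≤[1+m]Ck n k)

[k+1]*[m+1]C[k+1]≡[m+1]*mCk : ∀ m k → suc k * (suc m C suc k) ≡ suc m * (m C k)
[k+1]*[m+1]C[k+1]≡[m+1]*mCk zero    zero    = refl
[k+1]*[m+1]C[k+1]≡[m+1]*mCk zero    (suc k) = *-zeroʳ (suc (suc k))
[k+1]*[m+1]C[k+1]≡[m+1]*mCk (suc m) zero    = begin
  1 * (suc (suc m) C 1) ≡⟨ *-identityˡ _ ⟩
  suc (suc m) C 1       ≡⟨ nC1≡n (suc (suc m)) ⟩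
  suc (suc m)           ≡⟨ *-identityʳ (suc (suc m)) ⟨
  suc (suc m) * 1       ∎
  where open ≡-Reasoning
[k+1]*[m+1]C[k+1]≡[m+1]*mCk (suc m) (suc k) = begin
  suc (suc k) * (suc (suc m) C suc (suc k))
    ≡⟨ cong (suc (suc k) *_) (nCk+nC[k+1]≡[n+1]C[k+1] (suc m) (suc k)) ⟨
  suc (suc k) * (a + b)
    ≡⟨ *-distribˡ-+ (suc (suc k)) a b ⟩
  (a + suc k * a) + suc (suc k) * b
    ≡⟨ cong₂ (λ x y → (a + x) + y) ([k+1]*[m+1]C[k+1]≡[m+1]*mCk m k) ([k+1]*[m+1]C[k+1]≡[m+1]*mCk m (suc k)) ⟩
  (a + suc m * (m C k)) + suc m * (m C suc k)
    ≡⟨ +-assoc a _ _ ⟩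
  a + (suc m * (m C k) + suc m * (m C suc k))
    ≡⟨ cong (a +_) (*-distribˡ-+ (suc m) (m C k) (m C suc k)) ⟨
  a + suc m * (m C k + m C suc k)
    ≡⟨ cong (λ x → a + suc m * x) (nCk+nC[k+1]≡[n+1]C[k+1] m k) ⟩
  suc (suc m) * a ∎
  where
  open ≡-Reasoning
  a = suc m C suc k
  b = suc m C suc (suc k)

fibre : Bool → List (Subset (suc n)) → List (Subset n)
fibre b []            = []
fibre b ((x ∷ A) ∷ L) with x ≟ b
... | yes _ = A ∷ fibre b L
... | no  _ = fibre b L

length-fibres : (L : List (Subset (suc n))) → length L ≡ length (fibre true L) + length (fibre false L)
length-fibres []                = refl
length-fibres ((true  ∷ A) ∷ L) = cong suc (length-fibres L)
length-fibres ((false ∷ A) ∷ L) = trans (cong suc (length-fibres L)) (sym (+-suc _ _))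

All-fibre : ∀ {P : Subset (suc n) → Set} b {L} → All P L → All (λ A → P (b ∷ A)) (fibre b L)
All-fibre b []                   = []
All-fibre b {(x ∷ A) ∷ L} (p ∷ ps) with x ≟ b
... | yes refl = p ∷ All-fibre b ps
... | no  _    = All-fibre b ps

Unique-fibre : ∀ b {L : List (Subset (suc n))} → Unique L → Unique (fibre b L)
Unique-fibre b []                          = []
Unique-fibre b {(x ∷ A) ∷ L} (A∉L ∷ unique) with x ≟ b
... | yes refl = All.map (λ A≢B A≡B → A≢B (cong (b ∷_) A≡B)) (All-fibre b A∉L) ∷ Unique-fibre b unique
... | no  _    = Unique-fibre b unique

All¬⇒length≡0 : ∀ {A : Set} {P : A → Set} {xs} → All P xs → (∀ x → ¬ P x) → length xs ≡ 0
All¬⇒length≡0 []      ¬P = refl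
All¬⇒length≡0 (p ∷ _) ¬P = contradiction p (¬P _)

MeetsAtLeast : Subset n → ℕ → ℕ → Subset n → Set
MeetsAtLeast U j k A = ∣ A ∣ ≡ j + k × j ≤ ∣ A ∩ U ∣

module Fibres (L : List (Subset (suc n))) where
  open ≤-Reasoning

  length-≤-double : ∀ p x → length (fibre true L) ≤ p * x → length (fibre false L) ≤ p * x →
                    length L ≤ 2 * p * x
  length-≤-double p x ≤px ≤px′ = begin
    length L                                       ≡⟨ length-fibres L ⟩
    length (fibre true L) + length (fibre false L) ≤⟨ +-mono-≤ ≤px ≤px′ ⟩
    p * x + p * x                                  ≡⟨ cong (p * x +_) (+-identityʳ (p * x)) ⟨
    2 * (p * x)                                    ≡⟨ *-assoc 2 p x ⟨
    2 * p * x                                      ∎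

  length-≤-pascal : ∀ p m k → length (fibre true L) ≤ p * (m C k) →
                    length (fibre false L) ≤ p * (m C suc k) → length L ≤ p * (suc m C suc k)
  length-≤-pascal p m k ≤pa ≤pb = begin
    length L                                       ≡⟨ length-fibres L ⟩
    length (fibre true L) + length (fibre false L) ≤⟨ +-mono-≤ ≤pa ≤pb ⟩
    p * (m C k) + p * (m C suc k)                  ≡⟨ *-distribˡ-+ p (m C k) (m C suc k) ⟨
    p * (m C k + m C suc k)                        ≡⟨ cong (p *_) (nCk+nC[k+1]≡[n+1]C[k+1] m k) ⟩
    p * (suc m C suc k)                            ∎

-- Split L by the first coordinate: a point of U doubles the bound, a point outside U
-- is absorbed by Pascal's rule.
length≤2^∣U∣*[n∸j]Ck : (U : Subset n) (j k : ℕ) {L : List (Subset n)} →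
                       Unique L → All (MeetsAtLeast U j k) L → length L ≤ 2 ^ ∣ U ∣ * ((n ∸ j) C k)
length≤2^∣U∣*[n∸j]Ck [] j       k       {[]}          _ _ = z≤n
length≤2^∣U∣*[n∸j]Ck [] zero    zero    {[] ∷ []}     _ _ = ≤-refl
length≤2^∣U∣*[n∸j]Ck [] zero    (suc k) {[] ∷ []}     _ ((() , _) ∷ [])
length≤2^∣U∣*[n∸j]Ck [] (suc j) k       {[] ∷ []}     _ ((() , _) ∷ [])
length≤2^∣U∣*[n∸j]Ck [] j       k       {[] ∷ [] ∷ _} ((≢[] ∷ _) ∷ _) _ = contradiction refl ≢[]
length≤2^∣U∣*[n∸j]Ck {suc n} (true ∷ U) (suc j) k {L} unique meets =
  length-≤-double (2 ^ ∣ U ∣) ((n ∸ j) C k)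
  (length≤2^∣U∣*[n∸j]Ck U j k (Unique-fibre true unique)
    (All.map (λ (∣A∣≡ , j≤) → suc-injective ∣A∣≡ , s≤s⁻¹ j≤) (All-fibre true meets)))
  (≤-trans (length≤2^∣U∣*[n∸j]Ck U (suc j) k (Unique-fibre false unique) (All-fibre false meets))
           (*-monoʳ-≤ (2 ^ ∣ U ∣) (C-monoˡ-≤ k (∸-monoʳ-≤ n (n≤1+n j)))))
  where open Fibres L
length≤2^∣U∣*[n∸j]Ck {suc n} (true ∷ U) zero zero {L} unique meets = length-≤-double (2 ^ ∣ U ∣) 1
  (≤-trans (≤-reflexive (All¬⇒length≡0 (All-fibre true meets) (λ _ ()))) z≤n)
  (length≤2^∣U∣*[n∸j]Ck U 0 0 (Unique-fibre false unique) (All-fibre false meets))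
  where open Fibres L
length≤2^∣U∣*[n∸j]Ck {suc n} (true ∷ U) zero (suc k) {L} unique meets = ≤-trans
  (length-≤-pascal (2 ^ ∣ U ∣) n k
    (length≤2^∣U∣*[n∸j]Ck U 0 k (Unique-fibre true unique)
      (All.map (λ (∣A∣≡ , _) → suc-injective ∣A∣≡ , z≤n) (All-fibre true meets)))
    (length≤2^∣U∣*[n∸j]Ck U 0 (suc k) (Unique-fibre false unique) (All-fibre false meets)))
  (*-monoˡ-≤ (suc n C suc k) (m≤n*m (2 ^ ∣ U ∣) 2))
  where open Fibres L
length≤2^∣U∣*[n∸j]Ck {suc n} (false ∷ U) j zero {L} unique meets = begin
  length L                                       ≡⟨ length-fibres L ⟩
  length (fibre true L) + length (fibre false L) ≡⟨ cong (_+ length (fibre false L)) no-true-fibre ⟩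
  length (fibre false L)                         ≤⟨ false-fibre ⟩
  2 ^ ∣ U ∣ * 1                                  ∎
  where
  open ≤-Reasoning
  false-fibre = length≤2^∣U∣*[n∸j]Ck U j 0 (Unique-fibre false unique) (All-fibre false meets)
  too-small : ∀ A → ¬ MeetsAtLeast (false ∷ U) j 0 (true ∷ A)
  too-small A (∣A∣≡ , j≤) = <⇒≱ (≤-reflexive (trans ∣A∣≡ (+-identityʳ j))) (≤-trans j≤ (∣p∩q∣≤∣p∣ A U))
  no-true-fibre = All¬⇒length≡0 (All-fibre true meets) too-small
length≤2^∣U∣*[n∸j]Ck {suc n} (false ∷ U) j (suc k) {L} unique meets with j ≤? n
... | yes j≤n = subst (λ m → length L ≤ 2 ^ ∣ U ∣ * (m C suc k)) (sym (+-∸-assoc 1 j≤n))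
  (length-≤-pascal (2 ^ ∣ U ∣) (n ∸ j) k
    (length≤2^∣U∣*[n∸j]Ck U j k (Unique-fibre true unique)
      (All.map (λ (∣A∣≡ , j≤) → suc-injective (trans ∣A∣≡ (+-suc j k)) , j≤) (All-fibre true meets)))
    (length≤2^∣U∣*[n∸j]Ck U j (suc k) (Unique-fibre false unique) (All-fibre false meets)))
  where open Fibres L
... | no j≰n = ≤-trans (≤-reflexive (All¬⇒length≡0 meets too-large)) z≤n
  where
  too-large : ∀ A → ¬ MeetsAtLeast (false ∷ U) j (suc k) A
  too-large A (∣A∣≡ , _) =
    j≰n (≤-trans (m≤m+n j k) (s≤s⁻¹ (≤-trans (≤-reflexive (trans (sym (+-suc j k)) (sym ∣A∣≡))) (∣p∣≤n A))))

∣p∪q∣≤∣p∣+∣q∣ : (p q : Subset n) → ∣ p ∪ q ∣ ≤ ∣ p ∣ + ∣ q ∣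
∣p∪q∣≤∣p∣+∣q∣ []          []          = z≤n
∣p∪q∣≤∣p∣+∣q∣ (true ∷ p)  (true ∷ q)  = s≤s (≤-trans (∣p∪q∣≤∣p∣+∣q∣ p q) (+-monoʳ-≤ ∣ p ∣ (n≤1+n ∣ q ∣)))
∣p∪q∣≤∣p∣+∣q∣ (true ∷ p)  (false ∷ q) = s≤s (∣p∪q∣≤∣p∣+∣q∣ p q)
∣p∪q∣≤∣p∣+∣q∣ (false ∷ p) (true ∷ q)  = subst (suc ∣ p ∪ q ∣ ≤_) (sym (+-suc ∣ p ∣ ∣ q ∣)) (s≤s (∣p∪q∣≤∣p∣+∣q∣ p q))
∣p∪q∣≤∣p∣+∣q∣ (false ∷ p) (false ∷ q) = ∣p∪q∣≤∣p∣+∣q∣ p q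

⋃[_]_ : Subset n → (Fin n → Subset m) → Subset m
⋃[ [] ]        B = ⊥
⋃[ true ∷ p ]  B = B zero ∪ ⋃[ p ] (B ∘ suc)
⋃[ false ∷ p ] B = ⋃[ p ] (B ∘ suc)

Bx⊆⋃[p]B : {p : Subset n} {x : Fin n} (B : Fin n → Subset m) → x ∈ p → B x ⊆ ⋃[ p ] B
Bx⊆⋃[p]B {p = true ∷ p} B here        = p⊆p∪q _
Bx⊆⋃[p]B {p = true ∷ p} B (there x∈p) = q⊆p∪q (B zero) _ ∘ Bx⊆⋃[p]B (B ∘ suc) x∈p
Bx⊆⋃[p]B {p = false ∷ p} B (there x∈p) = Bx⊆⋃[p]B (B ∘ suc) x∈p

∣⋃[p]B∣≤∣p∣*k : ∀ {k} (p : Subset n) (B : Fin n → Subset m) →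
                (∀ x → ∣ B x ∣ ≤ k) → ∣ ⋃[ p ] B ∣ ≤ ∣ p ∣ * k
∣⋃[p]B∣≤∣p∣*k {m = m} [] B ∣B∣≤k = ≤-reflexive (∣⊥∣≡0 m)
∣⋃[p]B∣≤∣p∣*k (true ∷ p) B ∣B∣≤k =
  ≤-trans (∣p∪q∣≤∣p∣+∣q∣ (B zero) _) (+-mono-≤ (∣B∣≤k zero) (∣⋃[p]B∣≤∣p∣*k p (B ∘ suc) (∣B∣≤k ∘ suc)))
∣⋃[p]B∣≤∣p∣*k (false ∷ p) B ∣B∣≤k = ∣⋃[p]B∣≤∣p∣*k p (B ∘ suc) (∣B∣≤k ∘ suc)

1≤∣p∣⇒Nonempty : (p : Subset n) → 1 ≤ ∣ p ∣ → Nonempty p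
1≤∣p∣⇒Nonempty (true ∷ p)  _       = zero , here
1≤∣p∣⇒Nonempty (false ∷ p) 1≤∣p∣ with 1≤∣p∣⇒Nonempty p 1≤∣p∣
... | x , x∈p = suc x , there x∈p

iF≤∣A∩B∣ : (F : List (Subset n)) (A : Subset n) {B : Subset n} → B ∈ₗ F → iF F A ≤ ∣ A ∩ B ∣
iF≤∣A∩B∣ (B ∷ F) A (here refl) = m⊓n≤m _ _
iF≤∣A∩B∣ (_ ∷ F) A (there B∈F) = ≤-trans (m⊓n≤n _ _) (iF≤∣A∩B∣ F A B∈F)

iF<∣A∩U∣ : (F : List (Subset n)) {A B U : Subset n} {x : Fin n} →
           B ∈ₗ F → B ⊆ U → x ∈ A → x ∈ U → x ∉ B → iF F A ℕ.< ∣ A ∩ U ∣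
iF<∣A∩U∣ F {A} {B} {U} B∈F B⊆U x∈A x∈U x∉B = ≤-<-trans (iF≤∣A∩B∣ F A B∈F) (p⊂q⇒∣p∣<∣q∣ A∩B⊂A∩U)
  where
  A∩B⊂A∩U : A ∩ B ⊂ A ∩ U
  A∩B⊂A∩U = (λ y∈A∩B → let y∈A , y∈B = x∈p∩q⁻ A B y∈A∩B in x∈p∩q⁺ (y∈A , B⊆U y∈B))
          , _ , x∈p∩q⁺ (x∈A , x∈U) , x∉B ∘ proj₂ ∘ x∈p∩q⁻ A B

iF-witness-set : ∀ {r} (F : List (Subset n)) → All (λ A → ∣ A ∣ ≤ r) F →
                 ((x : Fin n) → Any (λ A → x ∉ A) F) → Any (λ A → 1 ≤ iF F A) F →
                 ∃ λ U → ∣ U ∣ ≤ r + r * r × All (λ A → iF F A ℕ.< ∣ A ∩ U ∣) F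
iF-witness-set {r = r} F ∣F∣≤r ⋂F≡∅ G₁≢∅ with find G₁≢∅
... | A₀ , A₀∈F , 1≤iF[A₀] = A₀ ∪ ⋃[ A₀ ] B , ∣U∣≤r+r*r , All.tabulate iF[A]<∣A∩U∣
  where
  B : Fin _ → Subset _
  B x = proj₁ (find (⋂F≡∅ x))

  B∈F : ∀ x → B x ∈ₗ F
  B∈F x = proj₁ (proj₂ (find (⋂F≡∅ x)))

  x∉B : ∀ x → x ∉ B x
  x∉B x = proj₂ (proj₂ (find (⋂F≡∅ x)))

  ∣U∣≤r+r*r : ∣ A₀ ∪ ⋃[ A₀ ] B ∣ ≤ r + r * r
  ∣U∣≤r+r*r = ≤-trans (∣p∪q∣≤∣p∣+∣q∣ A₀ _) (+-mono-≤ ∣A₀∣≤r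
                (≤-trans (∣⋃[p]B∣≤∣p∣*k A₀ B (λ x → All.lookup ∣F∣≤r (B∈F x))) (*-monoˡ-≤ r ∣A₀∣≤r)))
    where ∣A₀∣≤r = All.lookup ∣F∣≤r A₀∈F

  iF[A]<∣A∩U∣ : ∀ {A} → A ∈ₗ F → iF F A ℕ.< ∣ A ∩ (A₀ ∪ ⋃[ A₀ ] B) ∣
  iF[A]<∣A∩U∣ {A} A∈F with 1≤∣p∣⇒Nonempty (A₀ ∩ A) (≤-trans 1≤iF[A₀] (iF≤∣A∩B∣ F A₀ A∈F))
  ... | x , x∈A₀∩A = let x∈A₀ , x∈A = x∈p∩q⁻ A₀ A x∈A₀∩A in
    iF<∣A∩U∣ F (B∈F x) (q⊆p∪q A₀ _ ∘ Bx⊆⋃[p]B B x∈A₀) x∈A (p⊆p∪q _ x∈A₀) (x∉B x)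

private variable p q : ℚᵘ

fromℚᵘ-mono-≤ : p ℚᵘ.≤ q → fromℚᵘ p ℚ.≤ fromℚᵘ q
fromℚᵘ-mono-≤ {p} {q} p≤q = ℚ.toℚᵘ-cancel-≤
  (ℚᵘ.≤-respˡ-≃ (ℚᵘ.≃-sym (ℚ.toℚᵘ-fromℚᵘ p)) (ℚᵘ.≤-respʳ-≃ (ℚᵘ.≃-sym (ℚ.toℚᵘ-fromℚᵘ q)) p≤q))

fromℚᵘ-mono-< : p ℚᵘ.< q → fromℚᵘ p < fromℚᵘ q
fromℚᵘ-mono-< {p} {q} p<q = ℚ.toℚᵘ-cancel-<
  (ℚᵘ.<-respˡ-≃ (ℚᵘ.≃-sym (ℚ.toℚᵘ-fromℚᵘ p)) (ℚᵘ.<-respʳ-≃ (ℚᵘ.≃-sym (ℚ.toℚᵘ-fromℚᵘ q)) p<q))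

fromℚᵘ-homo-+ : ∀ p q → fromℚᵘ (p ℚᵘ.+ q) ≡ fromℚᵘ p ℚ.+ fromℚᵘ q
fromℚᵘ-homo-+ p q = ℚ.toℚᵘ-injective (ℚᵘ.≃-trans (ℚ.toℚᵘ-fromℚᵘ (p ℚᵘ.+ q)) (ℚᵘ.≃-sym (ℚᵘ.≃-trans
  (ℚ.toℚᵘ-homo-+ (fromℚᵘ p) (fromℚᵘ q)) (ℚᵘ.+-cong (ℚ.toℚᵘ-fromℚᵘ p) (ℚ.toℚᵘ-fromℚᵘ q)))))

-- ℤ.+ a / suc b is definitionally fromℚᵘ (mkℚᵘ (ℤ.+ a) b), so comparisons reduce to
-- cross-multiplication in ℚᵘ.
a/b≤c/d : ∀ a b c d → a * suc d ≤ c * suc b → ℤ.+ a / suc b ℚ.≤ ℤ.+ c / suc d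
a/b≤c/d a b c d ad≤cb = fromℚᵘ-mono-≤ {mkℚᵘ (ℤ.+ a) b} {mkℚᵘ (ℤ.+ c) d}
  (*≤* (subst₂ ℤ._≤_ (ℤ.pos-* a (suc d)) (ℤ.pos-* c (suc b)) (+≤+ ad≤cb)))

a/b<c/d : ∀ a b c d → a * suc d ℕ.< c * suc b → ℤ.+ a / suc b < ℤ.+ c / suc d
a/b<c/d a b c d ad<cb = fromℚᵘ-mono-< {mkℚᵘ (ℤ.+ a) b} {mkℚᵘ (ℤ.+ c) d}
  (*<* (subst₂ ℤ._<_ (ℤ.pos-* a (suc d)) (ℤ.pos-* c (suc b)) (+<+ ad<cb)))

a/d+b/d≃[a+b]/d : ∀ a b d → mkℚᵘ (ℤ.+ a) d ℚᵘ.+ mkℚᵘ (ℤ.+ b) d ℚᵘ.≃ mkℚᵘ (ℤ.+ (a + b)) d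
a/d+b/d≃[a+b]/d a b d = *≡* (begin
  (A ℤ.* D ℤ.+ B ℤ.* D) ℤ.* D  ≡⟨ cong (ℤ._* D) (ℤ.*-distribʳ-+ D A B) ⟨
  (A ℤ.+ B) ℤ.* D ℤ.* D         ≡⟨ ℤ.*-assoc (A ℤ.+ B) D D ⟩
  (A ℤ.+ B) ℤ.* (D ℤ.* D)       ≡⟨ cong₂ ℤ._*_ (ℤ.pos-+ a b) (ℤ.pos-* (suc d) (suc d)) ⟨
  ℤ.+ (a + b) ℤ.* ℤ.+ (suc d * suc d) ∎)
  where
  open ≡-Reasoning
  A = ℤ.+ a
  B = ℤ.+ b
  D = ℤ.+ suc d

k×1/d≡k/d : ∀ k d → k ×ℚ (ℤ.+ 1 / suc d) ≡ ℤ.+ k / suc d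
k×1/d≡k/d zero    d = sym (ℚ.0/n≡0 (suc d))
k×1/d≡k/d (suc k) d = begin
  ℤ.+ 1 / suc d ℚ.+ k ×ℚ (ℤ.+ 1 / suc d)      ≡⟨ cong (ℚ._+_ (ℤ.+ 1 / suc d)) (k×1/d≡k/d k d) ⟩
  ℤ.+ 1 / suc d ℚ.+ ℤ.+ k / suc d             ≡⟨ fromℚᵘ-homo-+ (mkℚᵘ (ℤ.+ 1) d) (mkℚᵘ (ℤ.+ k) d) ⟨
  fromℚᵘ (mkℚᵘ (ℤ.+ 1) d ℚᵘ.+ mkℚᵘ (ℤ.+ k) d) ≡⟨ ℚ.fromℚᵘ-cong (a/d+b/d≃[a+b]/d 1 k d) ⟩
  ℤ.+ suc k / suc d                           ∎
  where open ≡-Reasoning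

k×recipℕc≤1/[1+r] : ∀ r k c → suc r * k ≤ c → k ×ℚ recipℕ c ℚ.≤ ℤ.+ 1 / suc r
k×recipℕc≤1/[1+r] r zero    c       _       = a/b≤c/d 0 0 1 r z≤n
k×recipℕc≤1/[1+r] r (suc k) (suc c) [1+r]k≤c = begin
  suc k ×ℚ (ℤ.+ 1 / suc c) ≡⟨ k×1/d≡k/d (suc k) c ⟩
  ℤ.+ suc k / suc c        ≤⟨ a/b≤c/d (suc k) c 1 r [1+k][1+r]≤1*[1+c] ⟩
  ℤ.+ 1 / suc r            ∎
  where
  open ℚ.≤-Reasoning
  [1+k][1+r]≤1*[1+c] = subst₂ _≤_ (*-comm (suc r) (suc k)) (sym (+-identityʳ (suc c))) [1+r]k≤c

sumℚ-partition : ∀ {X : Set} {P : X → Set} (f : X → ℚ) (P? : U.Decidable P) xs →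
  sumℚ (map f xs) ≡ sumℚ (map f (filter P? xs)) ℚ.+ sumℚ (map f (filter (¬? ∘ P?) xs))
sumℚ-partition f P? []       = refl
sumℚ-partition f P? (x ∷ xs) with P? x
... | yes _ = trans (cong (f x ℚ.+_) (sumℚ-partition f P? xs)) (sym (ℚ.+-assoc (f x) _ _))
... | no  _ = trans (cong (f x ℚ.+_) (sumℚ-partition f P? xs))
                  (x∙yz≈y∙xz (f x) (sumℚ (map f (filter P? xs))) (sumℚ (map f (filter (¬? ∘ P?) xs))))
  where open CommSemigroup (CommutativeMonoid.commutativeSemigroup ℚ.+-0-commutativeMonoid)

sumℚ-const : ∀ {X : Set} {f : X → ℚ} {q xs} → All (λ x → f x ≡ q) xs → sumℚ (map f xs) ≡ length xs ×ℚ q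
sumℚ-const []           = refl
sumℚ-const (fx≡q ∷ fxs≡q) = cong₂ ℚ._+_ fx≡q (sumℚ-const fxs≡q)

sumℚ-≤-by-level : ∀ {X : Set} {Q : X → Set} (level : X → ℕ) (w : ℕ → ℚ) (c : ℚ) →
  (∀ i {L} → Unique L → All (λ x → Q x × level x ≡ i) L → length L ×ℚ w i ℚ.≤ c) →
  ∀ m {L} → Unique L → All Q L → All (λ x → level x ℕ.< m) L → sumℚ (map (w ∘ level) L) ℚ.≤ m ×ℚ c
sumℚ-≤-by-level level w c per-level zero    {[]}    _ _ _        = ℚ.≤-refl
sumℚ-≤-by-level level w c per-level zero    {_ ∷ _} _ _ (() ∷ _)
sumℚ-≤-by-level {Q = Q} level w c per-level (suc m) {L} unique Qs <1+m = begin
  sumℚ (map (w ∘ level) L)                                           ≡⟨ sumℚ-partition (w ∘ level) <m? L ⟩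
  sumℚ (map (w ∘ level) (filter <m? L)) ℚ.+ sumℚ (map (w ∘ level) L≡m) ≤⟨ ℚ.+-mono-≤ below at-m ⟩
  m ×ℚ c ℚ.+ c                                                       ≡⟨ ℚ.+-comm (m ×ℚ c) c ⟩
  suc m ×ℚ c                                                         ∎
  where
  open ℚ.≤-Reasoning
  <m? : U.Decidable (λ x → level x ℕ.< m)
  <m? x = level x <? m

  L≡m = filter (¬? ∘ <m?) L
  below : sumℚ (map (w ∘ level) (filter <m? L)) ℚ.≤ m ×ℚ c
  below = sumℚ-≤-by-level level w c per-level m
            (Unique.filter⁺ <m? unique) (All.filter⁺ <m? Qs) (All.all-filter <m? L)
  level≡m : All (λ x → Q x × level x ≡ m) L≡m
  level≡m = All.zipWith (λ ((Qx , <1+m) , ≮m) → Qx , ≤-antisym (s≤s⁻¹ <1+m) (≮⇒≥ ≮m))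
         (All.filter⁺ (¬? ∘ <m?) (All.zip (Qs , <1+m)) , All.all-filter (¬? ∘ <m?) L)
  at-m : sumℚ (map (w ∘ level) L≡m) ℚ.≤ c
  at-m = ℚ.≤-trans (ℚ.≤-reflexive (sumℚ-const (All.map (cong w ∘ proj₂) level≡m)))
                   (per-level m (Unique.filter⁺ (¬? ∘ <m?) unique) level≡m)

m∸n≡1+[m∸1+n] : ∀ {m n} → n ℕ.< m → m ∸ n ≡ suc (m ∸ suc n)
m∸n≡1+[m∸1+n] = +-∸-assoc 1

c*len≤[1+m]C[1+k] : ∀ {len p c} m k → len ≤ p * (m C k) → suc k * c * p ≤ suc m → c * len ≤ suc m C suc k
c*len≤[1+m]C[1+k] {len} {p} {c} m k len≤p*mCk [1+k]cp≤1+m = *-cancelˡ-≤ (suc k) (begin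
  suc k * (c * len)         ≤⟨ *-monoʳ-≤ (suc k) (*-monoʳ-≤ c len≤p*mCk) ⟩
  suc k * (c * (p * (m C k))) ≡⟨ trans (*-assoc (suc k * c) p (m C k)) (*-assoc (suc k) c (p * (m C k))) ⟨
  suc k * c * p * (m C k)   ≤⟨ *-monoˡ-≤ (m C k) [1+k]cp≤1+m ⟩
  suc m * (m C k)           ≡⟨ [k+1]*[m+1]C[k+1]≡[m+1]*mCk m k ⟨
  suc k * (suc m C suc k)   ∎)
  where open ≤-Reasoning

N : ℕ → ℕ
N r = r * suc r * 2 ^ (r + r * r)

level-contribution≤1/[1+r] : ∀ {n} r (U : Subset n) → ∣ U ∣ ≤ r + r * r → N r ≤ n ∸ r →
  ∀ i {L} → Unique L → All (λ A → ∣ A ∣ ≡ r × i ℕ.< ∣ A ∩ U ∣) L →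
  length L ×ℚ recipℕ ((n ∸ i) C (r ∸ i)) ℚ.≤ ℤ.+ 1 / suc r
level-contribution≤1/[1+r] r U _ _ i {[]} _ _ = k×recipℕc≤1/[1+r] r 0 1 (subst (_≤ 1) (sym (*-zeroʳ (suc r))) z≤n)
level-contribution≤1/[1+r] {n} r U ∣U∣≤r+r*r N≤n∸r i {L@(A ∷ _)} unique As@((∣A∣≡r , i<∣A∩U∣) ∷ _) =
  k×recipℕc≤1/[1+r] r (length L) _
    (subst₂ (λ a b → suc r * length L ≤ a C b) (sym (m∸n≡1+[m∸1+n] i<n)) (sym (m∸n≡1+[m∸1+n] i<r))
      (c*len≤[1+m]C[1+k] {p = 2 ^ ∣ U ∣} {c = suc r} (n ∸ suc i) (r ∸ suc i) counted small))
  where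
  i<r : i ℕ.< r
  i<r = ≤-trans i<∣A∩U∣ (≤-trans (∣p∩q∣≤∣p∣ A U) (≤-reflexive ∣A∣≡r))

  i<n : i ℕ.< n
  i<n = ≤-trans i<∣A∩U∣ (∣p∣≤n (A ∩ U))

  counted : length L ≤ 2 ^ ∣ U ∣ * ((n ∸ suc i) C (r ∸ suc i))
  counted = length≤2^∣U∣*[n∸j]Ck U (suc i) (r ∸ suc i) unique
    (All.map (λ (∣A∣≡r , i<∣A∩U∣) → trans ∣A∣≡r (sym (m+[n∸m]≡n i<r)) , i<∣A∩U∣) As)

  small : suc (r ∸ suc i) * suc r * 2 ^ ∣ U ∣ ≤ suc (n ∸ suc i)
  small = begin
    suc (r ∸ suc i) * suc r * 2 ^ ∣ U ∣ ≤⟨ *-mono-≤ (*-monoˡ-≤ (suc r) r∸i≤r) (^-monoʳ-≤ 2 ∣U∣≤r+r*r) ⟩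
    N r                                 ≤⟨ N≤n∸r ⟩
    n ∸ r                               ≤⟨ ∸-monoʳ-≤ n (<⇒≤ i<r) ⟩
    n ∸ i                               ≡⟨ m∸n≡1+[m∸1+n] i<n ⟩
    suc (n ∸ suc i)                     ∎
    where
    open ≤-Reasoning
    r∸i≤r = subst (_≤ r) (m∸n≡1+[m∸1+n] i<r) (m∸n≤m r i)

lemma5p3 : (r : ℕ) → 1 ≤ r → ∃ λ (N : ℕ) →
    (n : ℕ) (F : List (Subset n)) →
    Unique F →
    All (λ A → ∣ A ∣ ≡ r) F →
    ((x : Fin n) → Any (λ A → x ∉ A) F) →
    Any (λ A → 1 ≤ iF F A) F →
    N ≤ n ∸ r →
    Φ n r F < 1ℚ
-- The bound Φ ≤ r / (r + 1) holds for every r.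
lemma5p3 r _ = N r , Φ<1
  where
  Φ<1 : (n : ℕ) (F : List (Subset n)) → Unique F → All (λ A → ∣ A ∣ ≡ r) F →
        ((x : Fin n) → Any (λ A → x ∉ A) F) → Any (λ A → 1 ≤ iF F A) F → N r ≤ n ∸ r → Φ n r F < 1ℚ
  Φ<1 n F unique sizes ⋂F≡∅ G₁≢∅ N≤n∸r with iF-witness-set F (All.map ≤-reflexive sizes) ⋂F≡∅ G₁≢∅
  ... | U , ∣U∣≤r+r*r , iF<∣A∩U∣ = begin-strict
    Φ n r F                ≤⟨ sumℚ-≤-by-level (iF F) w (ℤ.+ 1 / suc r) per-level r unique Qs iF<r ⟩
    r ×ℚ (ℤ.+ 1 / suc r)   ≡⟨ k×1/d≡k/d r r ⟩
    ℤ.+ r / suc r          <⟨ a/b<c/d r r 1 0 r*1<1*[1+r] ⟩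
    1ℚ                     ∎
    where
    open ℚ.≤-Reasoning
    w : ℕ → ℚ
    w i = recipℕ ((n ∸ i) C (r ∸ i))
    per-level : ∀ i {L} → Unique L → All (λ A → (∣ A ∣ ≡ r × iF F A ℕ.< ∣ A ∩ U ∣) × iF F A ≡ i) L →
                length L ×ℚ w i ℚ.≤ ℤ.+ 1 / suc r
    per-level i unique As = level-contribution≤1/[1+r] r U ∣U∣≤r+r*r N≤n∸r i unique
      (All.map (λ ((∣A∣≡r , iF<∣A∩U∣) , iF≡i) → ∣A∣≡r , subst (ℕ._< _) iF≡i iF<∣A∩U∣) As)
    Qs : All (λ A → ∣ A ∣ ≡ r × iF F A ℕ.< ∣ A ∩ U ∣) F
    Qs = All.zip (sizes , iF<∣A∩U∣)
    iF<r : All (λ A → iF F A ℕ.< r) F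
    iF<r = All.map (λ {A} (∣A∣≡r , iF<∣A∩U∣) → ≤-trans iF<∣A∩U∣ (≤-trans (∣p∩q∣≤∣p∣ A U) (≤-reflexive ∣A∣≡r))) Qs
    r*1<1*[1+r] : r * 1 ℕ.< 1 * suc r
    r*1<1*[1+r] = subst₂ ℕ._<_ (sym (*-identityʳ r)) (sym (*-identityˡ (suc r))) (n<1+n r)
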